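{- For every integer $m\ge 5$, $$\gamma_{\mathrm{sdR}}(G_{2,m})=\begin{cases} m+1 & \text{if } m\equiv 1\pmod 4,\\ m & \text{otherwise}.\end{cases}$$
   Context: The $2\times m$ grid graph $G_{2,m}$ has vertex set $\{0,1\}\times\{0,\dots,m-1\}$, two vertices being adjacent iff their Euclidean distance is $1$. $N(u)$ is the open neighborhood, $N[u]=N(u)\cup\{u\}$; for $f:V\to\{ -1,1,2,3\}$, $V_i=f^{ -1}(i)$, $f(S)=\sum_{s\in S}f(s)$. A signed double Roman domination function (SDRDF) is $f:V\to\{ -1,1,2,3\}$ with: (1) every $u\in V_{ -1}$ has a neighbor in $V_3$ or at least two distinct neighbors in $V_2$; (2) every $u\in V_1$ has a neighbor in $V_2\cup V_3$; (3) $f(N[u])\ge1$ for all $u$. $\gamma_{\mathrm{sdR}}(G)$ is the minimum of $f(V)$ over all SDRDFs on $G$. -}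

module Defs where

open import Data.Nat as ℕ using (ℕ; _%_)
open import Data.Nat.Properties as ℕP using ()
open import Data.Integer as ℤ using (ℤ; +_; -[1+_]; _≤_)
open import Data.Fin using (Fin; toℕ)
open import Data.Fin.Properties using () renaming (_≟_ to _≟F_)
open import Data.Product using (_×_; _,_; ∃; ∃-syntax; proj₁; proj₂)
open import Data.Product.Properties using (≡-dec)
open import Data.Sum using (_⊎_)
open import Data.Bool using (Bool; true; false; _∧_; _∨_; not; T)
open import Data.List using (List; map; filter; foldr; allFin; cartesianProduct)
open import Relation.Nullary.Decidable using (⌊_⌋; T?)
open import Relation.Binary.PropositionalEquality using (_≡_; _≢_)

data Label : Set where
  neg1 one two three : Label

val : Label → ℤ
val neg1  = -[1+ 0 ]
val one   = + 1
val two   = + 2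
val three = + 3

Vertex : ℕ → Set
Vertex m = Fin 2 × Fin m

vertices : (m : ℕ) → List (Vertex m)
vertices m = cartesianProduct (allFin 2) (allFin m)

distOne : ℕ → ℕ → Bool
distOne a b = ⌊ ℕ.suc a ℕP.≟ b ⌋ ∨ ⌊ ℕ.suc b ℕP.≟ a ⌋

-- adjacency: Euclidean distance 1
adj : {m : ℕ} → Vertex m → Vertex m → Bool
adj (r , c) (r' , c') =
  (⌊ r ≟F r' ⌋ ∧ distOne (toℕ c) (toℕ c')) ∨ (⌊ c ≟F c' ⌋ ∧ not ⌊ r ≟F r' ⌋)

Adj : {m : ℕ} → Vertex m → Vertex m → Set
Adj u v = T (adj u v)

Labelling : ℕ → Set
Labelling m = Vertex m → Label

ℤsum : List ℤ → ℤ
ℤsum = foldr ℤ._+_ (+ 0)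

weight : {m : ℕ} → Labelling m → ℤ
weight {m} f = ℤsum (map (λ v → val (f v)) (vertices m))

closedNbhdWeight : {m : ℕ} → Labelling m → Vertex m → ℤ
closedNbhdWeight {m} f u =
  val (f u) ℤ.+ ℤsum (map (λ v → val (f v)) (filter (λ v → T? (adj u v)) (vertices m)))

record IsSDRDF {m : ℕ} (f : Labelling m) : Set where
  field
    cond1 : ∀ u → f u ≡ neg1 →
              (∃[ v ] (Adj u v × f v ≡ three))
              ⊎ (∃[ v ] ∃[ w ] (v ≢ w × Adj u v × Adj u w × f v ≡ two × f w ≡ two))
    cond2 : ∀ u → f u ≡ one →
              ∃[ v ] (Adj u v × (f v ≡ two ⊎ f v ≡ three))
    cond3 : ∀ u → + 1 ≤ closedNbhdWeight f u

GammaSdR≡ : ℕ → ℤ → Set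
GammaSdR≡ m k =
  (∃[ f ] (IsSDRDF {m} f × weight f ≡ k)) × (∀ (f : Labelling m) → IsSDRDF f → k ≤ weight f)

-- Cut G_{2,m} into its m columns, each a pair of labels. Every SDRDF condition at a vertex only
-- involves its own column and the two neighbouring ones, so f is an SDRDF iff every column is
-- dominated given its neighbours, and f(V) = m + Σ (f(column) - 1). The least value of that
-- excess over dominated runs of columns obeys a transfer-matrix recursion over the 16 possible
-- columns, indexed by the column before the run and the first column of the run. Evaluating the
-- recursion shows that its table repeats with period 4 from 5 columns on, and that the least
-- excess of 5, 6, 7, 8 columns is 1, 0, 0, 0. As the recursion is exact, these minima are
-- attained by SDRDFs.

module Submission where

open import Defs
open import Data.Nat using (ℕ; suc; _≤_; _%_)
open import Data.Integer using (+_)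
open import Data.Bool using (if_then_else_)
open import Relation.Nullary.Decidable using (⌊_⌋)
open import Data.Nat.Properties using (_≟_)

import Data.Nat as ℕ
import Data.Nat.DivMod as ℕ
import Data.Nat.Properties as ℕP
open import Data.Integer as ℤ using (ℤ; _+_; _-_)
import Data.Integer.Properties as ℤP
open import Data.Integer.Solver using (module +-*-Solver)
open import Algebra.Properties.CommutativeMonoid.Sum ℤP.+-0-commutativeMonoid
  using (sum; sum-cong-≗; sum-replicate-zero; sum-remove; ∑-comm)
open import Data.Bool using (Bool; true; false; T; _∧_)
open import Data.Bool.Properties using (T-∧; T-∨)
open import Data.Fin using (Fin; zero; suc; toℕ; inject₁)
open import Data.Fin.Properties using (any?; all?; toℕ-injective; toℕ-inject₁; punchInᵢ≢i)
  renaming (_≟_ to _≟ᶠ_)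
open import Data.List as List using (map; filter; _++_; allFin; cartesianProduct; tabulate)
import Data.List.Properties as List
open import Data.Maybe using (Maybe; just; nothing; maybe)
import Data.Maybe as Maybe
import Data.Maybe.Properties as Maybe
open import Data.Product using (_×_; _,_; proj₁; proj₂; ∃-syntax)
import Data.Product as Product
import Data.Product.Properties as Product
open import Data.Sum using (_⊎_; inj₁; inj₂; [_,_])
import Data.Sum as Sum
open import Data.Unit using (⊤; tt)
open import Data.Vec.Functional using (Vector; head; tail; []; _∷_; removeAt)
open import Function using (_∘_; Equivalence)
open import Relation.Binary.Definitions using (DecidableEquality)
open import Relation.Binary.PropositionalEquality
  using (_≡_; _≢_; _≗_; refl; sym; trans; cong; cong₂; subst; subst₂; module ≡-Reasoning)
open import Relation.Nullary using (¬_; Dec; yes; no; does; contradiction)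
open import Relation.Nullary.Decidable
  using (True; T?; toWitness; fromWitness; toWitnessFalse; fromWitnessFalse; dec-true; dec-false;
         _×-dec_; _⊎-dec_; ¬?)

ℤsum-++ : ∀ xs ys → ℤsum (xs ++ ys) ≡ ℤsum xs + ℤsum ys
ℤsum-++ List.[] ys = sym (ℤP.+-identityˡ _)
ℤsum-++ (x List.∷ xs) ys = trans (cong (_+_ x) (ℤsum-++ xs ys)) (sym (ℤP.+-assoc x _ _))

ℤsum-tabulate : ∀ {n} (h : Fin n → ℤ) → ℤsum (tabulate h) ≡ sum h
ℤsum-tabulate {ℕ.zero} h = refl
ℤsum-tabulate {suc n} h = cong (_+_ (h zero)) (ℤsum-tabulate (h ∘ suc))

ℤsum-allFin : ∀ {n} (h : Fin n → ℤ) → ℤsum (map h (allFin n)) ≡ sum h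
ℤsum-allFin h = trans (cong ℤsum (List.map-tabulate (λ i → i) h)) (ℤsum-tabulate h)

ℤsum-filter : ∀ {A : Set} (P : A → Bool) (h : A → ℤ) xs →
  ℤsum (map h (filter (T? ∘ P) xs)) ≡ ℤsum (map (λ x → if P x then h x else + 0) xs)
ℤsum-filter P h List.[] = refl
ℤsum-filter P h (x List.∷ xs) with P x
... | true  = cong (_+_ (h x)) (ℤsum-filter P h xs)
... | false = trans (ℤsum-filter P h xs) (sym (ℤP.+-identityˡ _))

ℤsum-cartesianProduct : ∀ {A B : Set} (h : A × B → ℤ) xs ys →
  ℤsum (map h (cartesianProduct xs ys)) ≡ ℤsum (map (λ x → ℤsum (map (h ∘ (x ,_)) ys)) xs)
ℤsum-cartesianProduct h List.[] ys = refl
ℤsum-cartesianProduct h (x List.∷ xs) ys = begin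
  ℤsum (map h (map (x ,_) ys ++ cartesianProduct xs ys))
    ≡⟨ cong ℤsum (List.map-++ h (map (x ,_) ys) _) ⟩
  ℤsum (map h (map (x ,_) ys) ++ map h (cartesianProduct xs ys))
    ≡⟨ ℤsum-++ (map h (map (x ,_) ys)) _ ⟩
  ℤsum (map h (map (x ,_) ys)) + ℤsum (map h (cartesianProduct xs ys))
    ≡⟨ cong₂ _+_ (cong ℤsum (sym (List.map-∘ ys))) (ℤsum-cartesianProduct h xs ys) ⟩
  ℤsum (map (h ∘ (x ,_)) ys) + ℤsum (map (λ x → ℤsum (map (h ∘ (x ,_)) ys)) xs)
    ∎
  where open ≡-Reasoning

ℤsum-vertices : ∀ {m} (h : Vertex m → ℤ) → ℤsum (map h (vertices m)) ≡ sum λ r → sum λ c → h (r , c)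
ℤsum-vertices {m} h = begin
  ℤsum (map h (vertices m))
    ≡⟨ ℤsum-cartesianProduct h (allFin 2) (allFin m) ⟩
  ℤsum (map (λ r → ℤsum (map (h ∘ (r ,_)) (allFin m))) (allFin 2))
    ≡⟨ cong ℤsum (List.map-cong (λ r → ℤsum-allFin (h ∘ (r ,_))) (allFin 2)) ⟩
  ℤsum (map (λ r → sum (h ∘ (r ,_))) (allFin 2))
    ≡⟨ ℤsum-allFin (λ r → sum (h ∘ (r ,_))) ⟩
  (sum λ r → sum λ c → h (r , c))
    ∎
  where open ≡-Reasoning

sum-zero : ∀ {n} {h : Fin n → ℤ} → (∀ i → h i ≡ + 0) → sum h ≡ + 0
sum-zero {n} h≗0 = trans (sum-cong-≗ h≗0) (sum-replicate-zero n)

sum-select : ∀ {n} (i : Fin n) {h : Fin n → ℤ} → (∀ j → j ≢ i → h j ≡ + 0) → sum h ≡ h i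
sum-select {suc n} i {h} h≗0 = begin
  sum h                       ≡⟨ sum-remove {i = i} h ⟩
  h i + sum (removeAt h i)    ≡⟨ cong (_+_ (h i)) (sum-zero (λ j → h≗0 _ (punchInᵢ≢i i j))) ⟩
  h i + + 0                   ≡⟨ ℤP.+-identityʳ (h i) ⟩
  h i                         ∎
  where open ≡-Reasoning

indicator : ∀ {A : Set} → Dec A → ℤ → ℤ
indicator a? x = if does a? then x else + 0

indicator-yes : ∀ {A : Set} (a? : Dec A) x → A → indicator a? x ≡ x
indicator-yes a? x a rewrite dec-true a? a = refl

indicator-no : ∀ {A : Set} (a? : Dec A) x → ¬ A → indicator a? x ≡ + 0
indicator-no a? x ¬a rewrite dec-false a? ¬a = refl

-- The conditions at a single vertex

_≟ℓ_ : DecidableEquality Label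
neg1  ≟ℓ neg1  = yes refl
neg1  ≟ℓ one   = no λ ()
neg1  ≟ℓ two   = no λ ()
neg1  ≟ℓ three = no λ ()
one   ≟ℓ neg1  = no λ ()
one   ≟ℓ one   = yes refl
one   ≟ℓ two   = no λ ()
one   ≟ℓ three = no λ ()
two   ≟ℓ neg1  = no λ ()
two   ≟ℓ one   = no λ ()
two   ≟ℓ two   = yes refl
two   ≟ℓ three = no λ ()
three ≟ℓ neg1  = no λ ()
three ≟ℓ one   = no λ ()
three ≟ℓ two   = no λ ()
three ≟ℓ three = yes refl

Slot : Set
Slot = Fin 3

pattern vertical = zero
pattern left     = suc zero
pattern right    = suc (suc zero)

-- The labels of the neighbours of a vertex; nothing where a row ends.
Around : Set
Around = Slot → Maybe Label

val? : Maybe Label → ℤ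
val? = maybe val (+ 0)

Sees : Around → Label → Set
Sees a ℓ = ∃[ s ] a s ≡ just ℓ

SeesTwice : Around → Label → Set
SeesTwice a ℓ = ∃[ s ] ∃[ t ] s ≢ t × a s ≡ just ℓ × a t ≡ just ℓ

Demand : Label → Around → Set
Demand neg1  a = Sees a three ⊎ SeesTwice a two
Demand one   a = Sees a two ⊎ Sees a three
Demand two   a = ⊤
Demand three a = ⊤

-- Conditions (1)-(3) on an SDRDF at a vertex labelled v with neighbours labelled a.
Dominated : Label → Around → Set
Dominated v a = Demand v a × + 1 ℤ.≤ val v + sum (val? ∘ a)

sees? : ∀ a ℓ → Dec (Sees a ℓ)
sees? a ℓ = any? λ s → Maybe.≡-dec _≟ℓ_ (a s) (just ℓ)

seesTwice? : ∀ a ℓ → Dec (SeesTwice a ℓ)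
seesTwice? a ℓ = any? λ s → any? λ t →
  ¬? (s ≟ᶠ t) ×-dec Maybe.≡-dec _≟ℓ_ (a s) (just ℓ) ×-dec Maybe.≡-dec _≟ℓ_ (a t) (just ℓ)

demand? : ∀ v a → Dec (Demand v a)
demand? neg1  a = sees? a three ⊎-dec seesTwice? a two
demand? one   a = sees? a two ⊎-dec sees? a three
demand? two   a = yes tt
demand? three a = yes tt

dominated? : ∀ v a → Dec (Dominated v a)
dominated? v a = demand? v a ×-dec (+ 1 ℤ.≤? val v + sum (val? ∘ a))

sees-resp-≗ : ∀ {a b ℓ} → a ≗ b → Sees a ℓ → Sees b ℓ
sees-resp-≗ a≗b (s , e) = s , trans (sym (a≗b s)) e

seesTwice-resp-≗ : ∀ {a b ℓ} → a ≗ b → SeesTwice a ℓ → SeesTwice b ℓ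
seesTwice-resp-≗ a≗b (s , t , s≢t , e , e′) = s , t , s≢t , trans (sym (a≗b s)) e , trans (sym (a≗b t)) e′

demand-resp-≗ : ∀ v {a b} → a ≗ b → Demand v a → Demand v b
demand-resp-≗ neg1  a≗b = Sum.map (sees-resp-≗ a≗b) (seesTwice-resp-≗ a≗b)
demand-resp-≗ one   a≗b = Sum.map (sees-resp-≗ a≗b) (sees-resp-≗ a≗b)
demand-resp-≗ two   _ _ = tt
demand-resp-≗ three _ _ = tt

dominated-resp : ∀ {v w a b} → v ≡ w → a ≗ b → Dominated v a → Dominated w b
dominated-resp {v} refl a≗b (d , positive) =
  demand-resp-≗ v a≗b d , subst (λ z → + 1 ℤ.≤ val v + z) (sum-cong-≗ (cong val? ∘ a≗b)) positive

other : Fin 2 → Fin 2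
other zero    = suc zero
other (suc _) = zero

≢-other : ∀ r → r ≢ other r
≢-other zero ()
≢-other (suc zero) ()

≢⇒≡other : ∀ {r r′} → r ≢ r′ → r′ ≡ other r
≢⇒≡other {zero}     {zero}     r≢r′ = contradiction refl r≢r′
≢⇒≡other {zero}     {suc zero} _    = refl
≢⇒≡other {suc zero} {zero}     _    = refl
≢⇒≡other {suc zero} {suc zero} r≢r′ = contradiction refl r≢r′

pred? : ∀ {m} → Fin m → Maybe (Fin m)
pred? zero    = nothing
pred? (suc i) = just (inject₁ i)

suc? : ∀ {m} → Fin m → Maybe (Fin m)
suc? {suc ℕ.zero}  zero    = nothing
suc? {suc (suc m)} zero    = just (suc zero)
suc? {suc (suc m)} (suc i) = Maybe.map suc (suc? i)

pred?-toℕ : ∀ {m} {c c′ : Fin m} → pred? c ≡ just c′ → suc (toℕ c′) ≡ toℕ c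
pred?-toℕ {c = suc i} refl = cong suc (toℕ-inject₁ i)

toℕ-pred? : ∀ {m} {c c′ : Fin m} → suc (toℕ c′) ≡ toℕ c → pred? c ≡ just c′
toℕ-pred? {c = suc i} e = cong just (toℕ-injective (trans (toℕ-inject₁ i) (sym (ℕP.suc-injective e))))

suc?-toℕ : ∀ {m} {c c′ : Fin m} → suc? c ≡ just c′ → suc (toℕ c) ≡ toℕ c′
suc?-toℕ {suc (suc m)} {zero} refl = refl
suc?-toℕ {suc (suc m)} {suc i} e with suc? i in eq
... | just j with refl ← e = cong suc (suc?-toℕ eq)

toℕ-suc? : ∀ {m} {c c′ : Fin m} → suc (toℕ c) ≡ toℕ c′ → suc? c ≡ just c′
toℕ-suc? {suc (suc m)} {zero}  {suc zero} refl = refl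
toℕ-suc? {suc (suc m)} {suc i} {suc j}    e    = cong (Maybe.map suc) (toℕ-suc? (ℕP.suc-injective e))

neighbour : ∀ {m} → Vertex m → Slot → Maybe (Vertex m)
neighbour (r , c) vertical = just (other r , c)
neighbour (r , c) left     = Maybe.map (r ,_) (pred? c)
neighbour (r , c) right    = Maybe.map (r ,_) (suc? c)

direction : ∀ {m} → Vertex m → Vertex m → Slot
direction (r , c) (r′ , c′) =
  if does (r ≟ᶠ r′) then (if does (toℕ c′ ℕ.<? toℕ c) then left else right) else vertical

neighbour-direction : ∀ {m} (u : Vertex m) s {v} → neighbour u s ≡ just v → s ≡ direction u v
neighbour-direction (r , c) vertical refl rewrite dec-false (r ≟ᶠ other r) (≢-other r) = refl
neighbour-direction (r , c) left e with pred? c in eq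
... | just c′ with refl ← e
  rewrite dec-true (r ≟ᶠ r) refl | dec-true (toℕ c′ ℕ.<? toℕ c) (ℕP.≤-reflexive (pred?-toℕ eq)) = refl
neighbour-direction (r , c) right e with suc? c in eq
... | just c′ with refl ← e
  rewrite dec-true (r ≟ᶠ r) refl
        | dec-false (toℕ c′ ℕ.<? toℕ c) (ℕP.<-asym (ℕP.≤-reflexive (suc?-toℕ eq))) = refl

neighbour-injective : ∀ {m} (u : Vertex m) s t {v} → neighbour u s ≡ just v → neighbour u t ≡ just v → s ≡ t
neighbour-injective u s t e e′ = trans (neighbour-direction u s e) (sym (neighbour-direction u t e′))

Consecutive : ℕ → ℕ → Set
Consecutive a b = suc a ≡ b ⊎ suc b ≡ a

-- T-∨ and T-∧ get their Booleans explicitly, since _∨_ and _∧_ are not injective.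
adjacent⇒ : ∀ {m} {r r′ : Fin 2} {c c′ : Fin m} → Adj (r , c) (r′ , c′) →
  (r ≡ r′ × Consecutive (toℕ c) (toℕ c′)) ⊎ (c ≡ c′ × r ≢ r′)
adjacent⇒ {r = r} {r′} {c} {c′} a
  with Equivalence.to (T-∨ {⌊ r ≟ᶠ r′ ⌋ ∧ distOne (toℕ c) (toℕ c′)}) a
... | inj₁ same-row with Equivalence.to (T-∧ {⌊ r ≟ᶠ r′ ⌋}) same-row
...   | r≡r′ , d = inj₁ (toWitness r≡r′ , Sum.map toWitness toWitness
                          (Equivalence.to (T-∨ {⌊ suc (toℕ c) ℕ.≟ toℕ c′ ⌋}) d))
adjacent⇒ {r = r} {r′} {c} {c′} a
    | inj₂ same-column with Equivalence.to (T-∧ {⌊ c ≟ᶠ c′ ⌋}) same-column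
...   | c≡c′ , r≢r′ = inj₂ (toWitness c≡c′ , toWitnessFalse r≢r′)

⇒adjacent : ∀ {m} {r r′ : Fin 2} {c c′ : Fin m} →
  (r ≡ r′ × Consecutive (toℕ c) (toℕ c′)) ⊎ (c ≡ c′ × r ≢ r′) → Adj (r , c) (r′ , c′)
⇒adjacent {r = r} {r′} {c} {c′} (inj₁ (r≡r′ , d)) =
  Equivalence.from (T-∨ {⌊ r ≟ᶠ r′ ⌋ ∧ distOne (toℕ c) (toℕ c′)}) (inj₁
    (Equivalence.from (T-∧ {⌊ r ≟ᶠ r′ ⌋}) (fromWitness r≡r′ ,
      Equivalence.from (T-∨ {⌊ suc (toℕ c) ℕ.≟ toℕ c′ ⌋}) (Sum.map fromWitness fromWitness d))))
⇒adjacent {r = r} {r′} {c} {c′} (inj₂ (c≡c′ , r≢r′)) =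
  Equivalence.from (T-∨ {⌊ r ≟ᶠ r′ ⌋ ∧ distOne (toℕ c) (toℕ c′)}) (inj₂
    (Equivalence.from (T-∧ {⌊ c ≟ᶠ c′ ⌋}) (fromWitness c≡c′ , fromWitnessFalse r≢r′)))

neighbour⇒adjacent : ∀ {m} (u : Vertex m) s {v} → neighbour u s ≡ just v → Adj u v
neighbour⇒adjacent (r , c) vertical refl = ⇒adjacent (inj₂ (refl , ≢-other r))
neighbour⇒adjacent (r , c) left e with pred? c in eq
... | just c′ with refl ← e = ⇒adjacent (inj₁ (refl , inj₂ (pred?-toℕ eq)))
neighbour⇒adjacent (r , c) right e with suc? c in eq
... | just c′ with refl ← e = ⇒adjacent (inj₁ (refl , inj₁ (suc?-toℕ eq)))

adjacent⇒neighbour : ∀ {m} (u v : Vertex m) → Adj u v → ∃[ s ] neighbour u s ≡ just v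
adjacent⇒neighbour (r , c) (r′ , c′) a with adjacent⇒ {r = r} {r′} {c} {c′} a
... | inj₁ (refl , inj₁ c<c′) = right , cong (Maybe.map (r ,_)) (toℕ-suc? c<c′)
... | inj₁ (refl , inj₂ c′<c) = left , cong (Maybe.map (r ,_)) (toℕ-pred? c′<c)
... | inj₂ (refl , r≢r′) rewrite ≢⇒≡other r≢r′ = vertical , refl

_≟ᵛ_ : ∀ {m} → DecidableEquality (Maybe (Vertex m))
_≟ᵛ_ = Maybe.≡-dec (Product.≡-dec _≟ᶠ_ _≟ᶠ_)

-- An adjacent vertex fills exactly one slot, so adjacency splits into one indicator per slot.
adj-indicator : ∀ {m} (u v : Vertex m) x →
  (if adj u v then x else + 0) ≡ sum λ s → indicator (neighbour u s ≟ᵛ just v) x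
adj-indicator u v x with adj u v in eq
... | true = begin
  x                                                  ≡⟨ indicator-yes (neighbour u s₀ ≟ᵛ just v) x e₀ ⟨
  indicator (neighbour u s₀ ≟ᵛ just v) x             ≡⟨ sum-select s₀ (λ t t≢s₀ →
                                                          indicator-no (neighbour u t ≟ᵛ just v) x
                                                            (λ e → t≢s₀ (neighbour-injective u t s₀ e e₀))) ⟨
  (sum λ s → indicator (neighbour u s ≟ᵛ just v) x)  ∎
  where
  open ≡-Reasoning
  slot = adjacent⇒neighbour u v (subst T (sym eq) _)
  s₀ = proj₁ slot
  e₀ = proj₂ slot
... | false = sym (sum-zero λ s → indicator-no (neighbour u s ≟ᵛ just v) x
                    (λ e → subst T eq (neighbour⇒adjacent u s e)))

sum-indicator : ∀ {m} (o : Maybe (Vertex m)) (h : Vertex m → ℤ) →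
  (sum λ r → sum λ c → indicator (o ≟ᵛ just (r , c)) (h (r , c))) ≡ maybe h (+ 0) o
sum-indicator {m} nothing h = sum-zero {2} λ r → sum-zero {m} λ c → refl
sum-indicator {m} (just (r₀ , c₀)) h = begin
  (sum λ r → sum λ c → indicator (just (r₀ , c₀) ≟ᵛ just (r , c)) (h (r , c)))
    ≡⟨ sum-select r₀ (λ r r≢r₀ → sum-zero {m} λ c →
         indicator-no (just (r₀ , c₀) ≟ᵛ just (r , c)) (h (r , c))
           (λ e → r≢r₀ (sym (cong proj₁ (Maybe.just-injective e))))) ⟩
  (sum λ c → indicator (just (r₀ , c₀) ≟ᵛ just (r₀ , c)) (h (r₀ , c)))
    ≡⟨ sum-select c₀ (λ c c≢c₀ →
         indicator-no (just (r₀ , c₀) ≟ᵛ just (r₀ , c)) (h (r₀ , c))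
           (λ e → c≢c₀ (sym (cong proj₂ (Maybe.just-injective e))))) ⟩
  indicator (just (r₀ , c₀) ≟ᵛ just (r₀ , c₀)) (h (r₀ , c₀))
    ≡⟨ indicator-yes (just (r₀ , c₀) ≟ᵛ just (r₀ , c₀)) _ refl ⟩
  h (r₀ , c₀)
    ∎
  where open ≡-Reasoning

around : ∀ {m} → Labelling m → Vertex m → Around
around f u s = Maybe.map f (neighbour u s)

closedNbhdWeight-around : ∀ {m} (f : Labelling m) u →
  closedNbhdWeight f u ≡ val (f u) + sum (val? ∘ around f u)
closedNbhdWeight-around {m} f u = cong (_+_ (val (f u))) (begin
  ℤsum (map g (filter (T? ∘ adj u) (vertices m)))
    ≡⟨ ℤsum-filter (adj u) g (vertices m) ⟩
  ℤsum (map (λ v → if adj u v then g v else + 0) (vertices m))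
    ≡⟨ ℤsum-vertices (λ v → if adj u v then g v else + 0) ⟩
  (sum λ r → sum λ c → if adj u (r , c) then g (r , c) else + 0)
    ≡⟨ sum-cong-≗ (λ r → sum-cong-≗ λ c → adj-indicator u (r , c) (g (r , c))) ⟩
  (sum λ r → sum λ c → sum λ s → hit s (r , c))
    ≡⟨ sum-cong-≗ (λ r → ∑-comm (λ c s → hit s (r , c))) ⟩
  (sum λ r → sum λ s → sum λ c → hit s (r , c))
    ≡⟨ ∑-comm (λ r s → sum λ c → hit s (r , c)) ⟩
  (sum λ s → sum λ r → sum λ c → hit s (r , c))
    ≡⟨ sum-cong-≗ (λ s → trans (sum-indicator (neighbour u s) g) (val?-map (neighbour u s))) ⟩
  sum (val? ∘ around f u)
    ∎)
  where
  open ≡-Reasoning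
  g = val ∘ f
  hit : Slot → Vertex m → ℤ
  hit s v = indicator (neighbour u s ≟ᵛ just v) (g v)
  val?-map : ∀ o → maybe g (+ 0) o ≡ val? (Maybe.map f o)
  val?-map nothing  = refl
  val?-map (just v) = refl

-- SDRDFs are the labellings dominated at every vertex

module _ {m} (f : Labelling m) where

  sees⇒adjacent : ∀ u {ℓ} → Sees (around f u) ℓ → ∃[ v ] Adj u v × f v ≡ ℓ
  sees⇒adjacent u (s , e) with neighbour u s in eq
  ... | just v = v , neighbour⇒adjacent u s eq , Maybe.just-injective e

  adjacent⇒sees : ∀ u {v ℓ} → Adj u v → f v ≡ ℓ → Sees (around f u) ℓ
  adjacent⇒sees u {v} a fv≡ℓ with adjacent⇒neighbour u v a
  ... | s , e = s , trans (cong (Maybe.map f) e) (cong just fv≡ℓ)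

  seesTwice⇒adjacent : ∀ u {ℓ} → SeesTwice (around f u) ℓ →
    ∃[ v ] ∃[ w ] v ≢ w × Adj u v × Adj u w × f v ≡ ℓ × f w ≡ ℓ
  seesTwice⇒adjacent u (s , t , s≢t , e , e′) with neighbour u s in eq | neighbour u t in eq′
  ... | just v | just w =
    v , w , (λ { refl → s≢t (neighbour-injective u s t eq eq′) }) ,
    neighbour⇒adjacent u s eq , neighbour⇒adjacent u t eq′ , Maybe.just-injective e , Maybe.just-injective e′

  adjacent⇒seesTwice : ∀ u {v w ℓ} → v ≢ w → Adj u v → Adj u w → f v ≡ ℓ → f w ≡ ℓ →
    SeesTwice (around f u) ℓ
  adjacent⇒seesTwice u {v} {w} v≢w a a′ fv≡ℓ fw≡ℓ
    with adjacent⇒neighbour u v a | adjacent⇒neighbour u w a′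
  ... | s , e | t , e′ =
    s , t , (λ { refl → v≢w (Maybe.just-injective (trans (sym e) e′)) }) ,
    trans (cong (Maybe.map f) e) (cong just fv≡ℓ) , trans (cong (Maybe.map f) e′) (cong just fw≡ℓ)

  sdrdf⇒dominated : IsSDRDF f → ∀ u → Dominated (f u) (around f u)
  sdrdf⇒dominated S u = demand , subst (+ 1 ℤ.≤_) (closedNbhdWeight-around f u) (IsSDRDF.cond3 S u)
    where
    demand : Demand (f u) (around f u)
    demand with f u in eq
    ... | neg1  = Sum.map (λ (v , a , e) → adjacent⇒sees u a e)
                    (λ (v , w , v≢w , a , a′ , e , e′) → adjacent⇒seesTwice u v≢w a a′ e e′)
                    (IsSDRDF.cond1 S u eq)
    ... | one   = let v , a , e = IsSDRDF.cond2 S u eq in Sum.map (adjacent⇒sees u a) (adjacent⇒sees u a) e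
    ... | two   = tt
    ... | three = tt

  dominated⇒sdrdf : (∀ u → Dominated (f u) (around f u)) → IsSDRDF f
  dominated⇒sdrdf D = record
    { cond1 = λ u e → Sum.map (sees⇒adjacent u) (seesTwice⇒adjacent u) (demand u e)
    ; cond2 = λ u e → [ Product.map₂ (Product.map₂ inj₁) ∘ sees⇒adjacent u
                      , Product.map₂ (Product.map₂ inj₂) ∘ sees⇒adjacent u ] (demand u e)
    ; cond3 = λ u → subst (+ 1 ℤ.≤_) (sym (closedNbhdWeight-around f u)) (proj₂ (D u))
    }
    where
    demand : ∀ u {ℓ} → f u ≡ ℓ → Demand ℓ (around f u)
    demand u refl = proj₁ (D u)

-- Columns and runs

Column : Set
Column = Label × Label

_at_ : Column → Fin 2 → Label
x at zero  = proj₁ x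
x at suc _ = proj₂ x

columnAround : Fin 2 → Maybe Column → Column → Maybe Column → Around
columnAround r p x q vertical = just (x at other r)
columnAround r p x q left     = Maybe.map (_at r) p
columnAround r p x q right    = Maybe.map (_at r) q

DominatedColumn : Maybe Column → Column → Maybe Column → Set
DominatedColumn p x q = ∀ r → Dominated (x at r) (columnAround r p x q)

dominatedColumn? : ∀ p x q → Dec (DominatedColumn p x q)
dominatedColumn? p x q = all? λ r → dominated? (x at r) (columnAround r p x q)

before : ∀ {A : Set} {n} → Maybe A → Vector A n → Fin n → Maybe A
before p g zero    = p
before p g (suc i) = just (g (inject₁ i))

DominatedWindows : Maybe Column → (n : ℕ) → Vector Column n → Set
DominatedWindows p n g = ∀ c → DominatedColumn (before p g c) (g c) (Maybe.map g (suc? c))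

column : ∀ {m} → Labelling m → Vector Column m
column f c = f (zero , c) , f (suc zero , c)

fromColumns : ∀ {m} → Vector Column m → Labelling m
fromColumns g (r , c) = g c at r

module _ {m} (f : Labelling m) where

  column-at : ∀ r c → column f c at r ≡ f (r , c)
  column-at zero       c = refl
  column-at (suc zero) c = refl

  around-column : ∀ r c → around f (r , c) ≗
    columnAround r (before nothing (column f) c) (column f c) (Maybe.map (column f) (suc? c))
  around-column r c       vertical = cong just (sym (column-at (other r) c))
  around-column r zero    left     = refl
  around-column r (suc i) left     = cong just (sym (column-at r (inject₁ i)))
  around-column r c       right with suc? c
  ... | nothing = refl
  ... | just c′ = cong just (sym (column-at r c′))

  dominated⇒windows : (∀ u → Dominated (f u) (around f u)) → DominatedWindows nothing m (column f)
  dominated⇒windows D c r = dominated-resp (sym (column-at r c)) (around-column r c) (D (r , c))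

  windows⇒dominated : DominatedWindows nothing m (column f) → ∀ u → Dominated (f u) (around f u)
  windows⇒dominated W (r , c) = dominated-resp (column-at r c) (sym ∘ around-column r c) (W c r)

head? : ∀ {A : Set} {n} → Vector A n → Maybe A
head? {n = ℕ.zero} _ = nothing
head? {n = suc n}  g = just (head g)

-- A run of columns following the column p, or starting the grid if p is nothing.
DominatedRun : Maybe Column → (n : ℕ) → Vector Column n → Set
DominatedRun p ℕ.zero  g = ⊤
DominatedRun p (suc n) g = DominatedColumn p (head g) (head? (tail g)) × DominatedRun (just (head g)) n (tail g)

before-tail : ∀ {A : Set} {n} p (g : Vector A (suc n)) i → before (just (head g)) (tail g) i ≡ before p g (suc i)
before-tail p g zero    = refl
before-tail p g (suc i) = refl

head?-tail : ∀ {A : Set} n (g : Vector A (suc n)) → head? (tail g) ≡ Maybe.map g (suc? zero)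
head?-tail ℕ.zero  g = refl
head?-tail (suc n) g = refl

suc?-tail : ∀ {A : Set} {n} (g : Vector A (suc n)) i → Maybe.map (tail g) (suc? i) ≡ Maybe.map g (suc? (suc i))
suc?-tail {n = suc n} g i = Maybe.map-∘ (suc? i)

run⇒windows : ∀ p n g → DominatedRun p n g → DominatedWindows p n g
run⇒windows p (suc n) g (d , run) zero = subst (DominatedColumn p (g zero)) (head?-tail n g) d
run⇒windows p (suc n) g (d , run) (suc i) =
  subst₂ (λ p′ q → DominatedColumn p′ (g (suc i)) q) (before-tail p g i) (suc?-tail g i)
    (run⇒windows (just (g zero)) n (tail g) run i)

windows⇒run : ∀ p n g → DominatedWindows p n g → DominatedRun p n g
windows⇒run p ℕ.zero  g W = tt
windows⇒run p (suc n) g W =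
  subst (DominatedColumn p (g zero)) (sym (head?-tail n g)) (W zero) ,
  windows⇒run (just (g zero)) n (tail g) λ i →
    subst₂ (λ p′ q → DominatedColumn p′ (g (suc i)) q) (sym (before-tail p g i)) (sym (suc?-tail g i)) (W (suc i))

sdrdf⇒dominatedRun : ∀ {m} (f : Labelling m) → IsSDRDF f → DominatedRun nothing m (column f)
sdrdf⇒dominatedRun {m} f S = windows⇒run nothing m (column f) (dominated⇒windows f (sdrdf⇒dominated f S))

dominatedRun⇒sdrdf : ∀ {m} (g : Vector Column m) → DominatedRun nothing m g → IsSDRDF (fromColumns g)
dominatedRun⇒sdrdf {m} g run =
  dominated⇒sdrdf (fromColumns g) (windows⇒dominated (fromColumns g) (run⇒windows nothing m g run))

columnWeight : Column → ℤ
columnWeight x = val (proj₁ x) + val (proj₂ x)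

surplus : Column → ℤ
surplus x = columnWeight x - + 1

excess : ∀ {n} → Vector Column n → ℤ
excess g = sum (surplus ∘ g)

sum-columnWeight : ∀ {n} (g : Vector Column n) → sum (columnWeight ∘ g) ≡ + n + excess g
sum-columnWeight {ℕ.zero} g = refl
sum-columnWeight {suc n}  g = begin
  w + sum (columnWeight ∘ tail g)   ≡⟨ cong (_+_ w) (sum-columnWeight (tail g)) ⟩
  w + (+ n + e)                     ≡⟨ solve 3 (λ w n e → w :+ (n :+ e) :=
                                                     (con (+ 1) :+ n) :+ ((w :- con (+ 1)) :+ e)) refl w (+ n) e ⟩
  + suc n + (surplus (head g) + e)  ∎
  where
  open ≡-Reasoning
  open +-*-Solver
  w = columnWeight (head g)
  e = excess (tail g)

weight-excess : ∀ {m} (f : Labelling m) → weight f ≡ + m + excess (column f)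
weight-excess {m} f = begin
  weight f                                   ≡⟨ ℤsum-vertices (val ∘ f) ⟩
  (sum λ r → sum λ c → val (f (r , c)))      ≡⟨ ∑-comm (λ r c → val (f (r , c))) ⟩
  (sum λ c → sum λ r → val (f (r , c)))      ≡⟨ sum-cong-≗ (λ c → cong (_+_ (val (f (zero , c))))
                                                                    (ℤP.+-identityʳ _)) ⟩
  sum (columnWeight ∘ column f)              ≡⟨ sum-columnWeight (column f) ⟩
  + m + excess (column f)                    ∎
  where open ≡-Reasoning

ℤ∞ : Set
ℤ∞ = Maybe ℤ

infix  4 _≼_
infixr 7 _⊓∞_
infixr 6 _+∞_

data _≼_ : ℤ∞ → ℤ∞ → Set where
  ≼-just : ∀ {x y} → x ℤ.≤ y → just x ≼ just y
  ≼-∞    : ∀ {u} → u ≼ nothing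

≼-refl : ∀ {u} → u ≼ u
≼-refl {just x}  = ≼-just ℤP.≤-refl
≼-refl {nothing} = ≼-∞

≼-trans : ∀ {u v w} → u ≼ v → v ≼ w → u ≼ w
≼-trans (≼-just x≤y) (≼-just y≤z) = ≼-just (ℤP.≤-trans x≤y y≤z)
≼-trans _ ≼-∞ = ≼-∞

_⊓∞_ : ℤ∞ → ℤ∞ → ℤ∞
nothing ⊓∞ v       = v
just x  ⊓∞ nothing = just x
just x  ⊓∞ just y  = just (x ℤ.⊓ y)

⊓∞-≼ˡ : ∀ u v → u ⊓∞ v ≼ u
⊓∞-≼ˡ nothing  v        = ≼-∞
⊓∞-≼ˡ (just x) nothing  = ≼-refl
⊓∞-≼ˡ (just x) (just y) = ≼-just (ℤP.i⊓j≤i x y)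

⊓∞-≼ʳ : ∀ u v → u ⊓∞ v ≼ v
⊓∞-≼ʳ nothing  v        = ≼-refl
⊓∞-≼ʳ (just x) nothing  = ≼-∞
⊓∞-≼ʳ (just x) (just y) = ≼-just (ℤP.i⊓j≤j x y)

⊓∞-sel : ∀ u v {e} → u ⊓∞ v ≡ just e → u ≡ just e ⊎ v ≡ just e
⊓∞-sel nothing  v        eq   = inj₂ eq
⊓∞-sel (just x) nothing  eq   = inj₁ eq
⊓∞-sel (just x) (just y) refl = Sum.map (cong just ∘ sym) (cong just ∘ sym) (ℤP.⊓-sel x y)

_+∞_ : ℤ → ℤ∞ → ℤ∞
a +∞ u = Maybe.map (λ e → a + e) u

+∞-monoʳ-≼ : ∀ a {u v} → u ≼ v → a +∞ u ≼ a +∞ v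
+∞-monoʳ-≼ a (≼-just x≤y) = ≼-just (ℤP.+-monoʳ-≤ a x≤y)
+∞-monoʳ-≼ a ≼-∞          = ≼-∞

+∞-just : ∀ a {u e} → a +∞ u ≡ just e → ∃[ e′ ] u ≡ just e′ × a + e′ ≡ e
+∞-just a {just e′} refl = e′ , refl , refl

guard : ∀ {A : Set} → Dec A → ℤ∞ → ℤ∞
guard a? u = if does a? then u else nothing

guard-yes : ∀ {A : Set} (a? : Dec A) u → A → guard a? u ≡ u
guard-yes a? u a rewrite dec-true a? a = refl

guard-just : ∀ {A : Set} (a? : Dec A) u {e} → guard a? u ≡ just e → A × u ≡ just e
guard-just (yes a) u eq = a , eq

minLabel : (Label → ℤ∞) → ℤ∞
minLabel h = h neg1 ⊓∞ h one ⊓∞ h two ⊓∞ h three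

minLabel-≼ : ∀ h ℓ → minLabel h ≼ h ℓ
minLabel-≼ h neg1  = ⊓∞-≼ˡ (h neg1) _
minLabel-≼ h one   = ≼-trans (⊓∞-≼ʳ (h neg1) _) (⊓∞-≼ˡ (h one) _)
minLabel-≼ h two   = ≼-trans (⊓∞-≼ʳ (h neg1) _) (≼-trans (⊓∞-≼ʳ (h one) _) (⊓∞-≼ˡ (h two) _))
minLabel-≼ h three = ≼-trans (⊓∞-≼ʳ (h neg1) _) (≼-trans (⊓∞-≼ʳ (h one) _) (⊓∞-≼ʳ (h two) _))

minLabel-attained : ∀ h {e} → minLabel h ≡ just e → ∃[ ℓ ] h ℓ ≡ just e
minLabel-attained h eq with ⊓∞-sel (h neg1) _ eq
... | inj₁ e = neg1 , e
... | inj₂ eq′ with ⊓∞-sel (h one) _ eq′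
...   | inj₁ e = one , e
...   | inj₂ eq″ with ⊓∞-sel (h two) _ eq″
...     | inj₁ e = two , e
...     | inj₂ e = three , e

minColumn : (Column → ℤ∞) → ℤ∞
minColumn h = minLabel λ a → minLabel λ b → h (a , b)

minColumn-≼ : ∀ h x → minColumn h ≼ h x
minColumn-≼ h (a , b) =
  ≼-trans (minLabel-≼ (λ a → minLabel λ b → h (a , b)) a) (minLabel-≼ (λ b → h (a , b)) b)

minColumn-attained : ∀ h {e} → minColumn h ≡ just e → ∃[ x ] h x ≡ just e
minColumn-attained h eq with minLabel-attained (λ a → minLabel λ b → h (a , b)) eq
... | a , eq′ with minLabel-attained (λ b → h (a , b)) eq′
...   | b , e = (a , b) , e

-- The least excess of a dominated run

-- Functions on labels stored as tuples: closed evaluations then share each table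
-- instead of recomputing it at every lookup.
Memo : Set → Set
Memo A = A × A × A × A

memo : ∀ {A : Set} → (Label → A) → Memo A
memo h = h neg1 , h one , h two , h three

infixl 9 _!_ _!²_ _!?_

_!_ : ∀ {A : Set} → Memo A → Label → A
(x , _ , _ , _) ! neg1  = x
(_ , x , _ , _) ! one   = x
(_ , _ , x , _) ! two   = x
(_ , _ , _ , x) ! three = x

memo-! : ∀ {A : Set} (h : Label → A) ℓ → memo h ! ℓ ≡ h ℓ
memo-! h neg1  = refl
memo-! h one   = refl
memo-! h two   = refl
memo-! h three = refl

≡-dec-Memo : ∀ {A : Set} → DecidableEquality A → DecidableEquality (Memo A)
≡-dec-Memo _≟ᴬ_ = Product.≡-dec _≟ᴬ_ (Product.≡-dec _≟ᴬ_ (Product.≡-dec _≟ᴬ_ _≟ᴬ_))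

Memo² : Set → Set
Memo² A = Memo (Memo A)

memo² : ∀ {A : Set} → (Column → A) → Memo² A
memo² h = memo λ a → memo λ b → h (a , b)

_!²_ : ∀ {A : Set} → Memo² A → Column → A
t !² (a , b) = t ! a ! b

memo²-! : ∀ {A : Set} (h : Column → A) x → memo² h !² x ≡ h x
memo²-! h (a , b) = trans (cong (_! b) (memo-! (λ a → memo λ b → h (a , b)) a)) (memo-! (λ b → h (a , b)) b)

Memo? : Set → Set
Memo? A = A × Memo² A

memo? : ∀ {A : Set} → (Maybe Column → A) → Memo? A
memo? h = h nothing , memo² (h ∘ just)

_!?_ : ∀ {A : Set} → Memo? A → Maybe Column → A
t !? nothing = proj₁ t
t !? just x  = proj₂ t !² x

memo?-! : ∀ {A : Set} (h : Maybe Column → A) p → memo? h !? p ≡ h p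
memo?-! h nothing  = refl
memo?-! h (just x) = memo²-! (h ∘ just) x

ExcessTable : Set
ExcessTable = Memo? (Memo² ℤ∞)

≡-dec-ExcessTable : DecidableEquality ExcessTable
≡-dec-ExcessTable = Product.≡-dec ≟² (≡-dec-Memo (≡-dec-Memo ≟²))
  where ≟² = ≡-dec-Memo (≡-dec-Memo (Maybe.≡-dec ℤ._≟_))

tabulateExcess : (Maybe Column → Column → ℤ∞) → ExcessTable
tabulateExcess h = memo? λ p → memo² (h p)

tabulateExcess-! : ∀ h p x → tabulateExcess h !? p !² x ≡ h p x
tabulateExcess-! h p x = trans (cong (_!² x) (memo?-! (memo² ∘ h) p)) (memo²-! (h p) x)

continuation : ExcessTable → Maybe Column → Column → Column → ℤ∞
continuation t p x y = guard (dominatedColumn? p x (just y)) (surplus x +∞ t !? just x !² y)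

extend : ExcessTable → ExcessTable
extend t = tabulateExcess λ p x → minColumn (continuation t p x)

-- Entry (p , x) of excessTable n concerns runs of n + 1 columns starting with x.
excessTable : ℕ → ExcessTable
excessTable ℕ.zero  = tabulateExcess λ p x → guard (dominatedColumn? p x nothing) (just (surplus x))
excessTable (suc n) = extend (excessTable n)

leastExcess : ℕ → Maybe Column → Column → ℤ∞
leastExcess n p x = excessTable n !? p !² x

leastExcess-zero : ∀ p x → leastExcess ℕ.zero p x ≡ guard (dominatedColumn? p x nothing) (just (surplus x))
leastExcess-zero = tabulateExcess-! _

leastExcess-suc : ∀ n p x → leastExcess (suc n) p x ≡ minColumn (continuation (excessTable n) p x)
leastExcess-suc n = tabulateExcess-! _

leastExcess-≼ : ∀ n p x (g : Vector Column n) → DominatedRun p (suc n) (x ∷ g) →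
  leastExcess n p x ≼ just (excess (x ∷ g))
leastExcess-≼ ℕ.zero p x g (d , _) =
  subst (_≼ just (excess (x ∷ g)))
    (sym (trans (leastExcess-zero p x) (guard-yes (dominatedColumn? p x nothing) (just (surplus x)) d)))
    (≼-just (ℤP.≤-reflexive (sym (ℤP.+-identityʳ (surplus x)))))
leastExcess-≼ (suc n) p x g (d , run) =
  subst (_≼ just (excess (x ∷ g))) (sym (leastExcess-suc n p x))
    (≼-trans (minColumn-≼ (continuation (excessTable n) p x) (head g))
      (subst (_≼ just (excess (x ∷ g))) (sym (guard-yes (dominatedColumn? p x (just (head g))) _ d))
        (+∞-monoʳ-≼ (surplus x) (leastExcess-≼ n (just x) (head g) (tail g) run))))

leastExcess-attained : ∀ n p x {e} → leastExcess n p x ≡ just e →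
  ∃[ g ] DominatedRun p (suc n) (x ∷ g) × excess (x ∷ g) ≡ e
leastExcess-attained ℕ.zero p x eq =
  let d , eq′ = guard-just (dominatedColumn? p x nothing) (just (surplus x)) (trans (sym (leastExcess-zero p x)) eq)
  in [] , (d , tt) , trans (ℤP.+-identityʳ (surplus x)) (Maybe.just-injective eq′)
leastExcess-attained (suc n) p x eq =
  let y , eq′ = minColumn-attained (continuation (excessTable n) p x) (trans (sym (leastExcess-suc n p x)) eq)
      d , eq″ = guard-just (dominatedColumn? p x (just y)) (surplus x +∞ leastExcess n (just x) y) eq′
      e′ , eq‴ , sum≡e = +∞-just (surplus x) eq″
      g , run , excess≡e′ = leastExcess-attained n (just x) y eq‴
  in (y ∷ g) , (d , run) , trans (cong (_+_ (surplus x)) excess≡e′) sum≡e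

minExcessOf : ExcessTable → ℤ∞
minExcessOf t = minColumn λ x → t !? nothing !² x

minExcess : ℕ → ℤ∞
minExcess n = minExcessOf (excessTable n)

minExcess-≤ : ∀ n {b} → minExcess n ≡ just b → (g : Vector Column (suc n)) → DominatedRun nothing (suc n) g →
  b ℤ.≤ excess g
minExcess-≤ n eq g run
  with subst (_≼ just (excess g)) eq
         (≼-trans (minColumn-≼ (leastExcess n nothing) (head g)) (leastExcess-≼ n nothing (head g) (tail g) run))
... | ≼-just b≤excess = b≤excess

minExcess-attained : ∀ n {e} → minExcess n ≡ just e → ∃[ g ] DominatedRun nothing (suc n) g × excess g ≡ e
minExcess-attained n eq =
  let x , eq′ = minColumn-attained (leastExcess n nothing) eq
      g , run , excess≡e = leastExcess-attained n nothing x eq′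
  in x ∷ g , run , excess≡e

minExcess⇒gammaSdR : ∀ n {b} → minExcess n ≡ just b → GammaSdR≡ (suc n) (+ suc n + b)
minExcess⇒gammaSdR n {b} eq = attained , lower-bound
  where
  attained : ∃[ f ] IsSDRDF f × weight f ≡ + suc n + b
  attained with minExcess-attained n eq
  ... | g , run , excess≡b =
    fromColumns g , dominatedRun⇒sdrdf g run ,
    trans (weight-excess (fromColumns g)) (cong (_+_ (+ suc n)) excess≡b)
  lower-bound : ∀ f → IsSDRDF f → + suc n + b ℤ.≤ weight f
  lower-bound f S = subst (_ ℤ.≤_) (sym (weight-excess f))
    (ℤP.+-monoʳ-≤ (+ suc n) (minExcess-≤ n eq (column f) (sdrdf⇒dominatedRun f S)))

-- Evaluating the recursion

by-decision : ∀ {A : Set} (_≟ᴬ_ : DecidableEquality A) {x y : A} → True (x ≟ᴬ y) → x ≡ y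
by-decision _ = toWitness

-- With k on the left, excessTable (suc k + 8) unfolds at once to extend (excessTable (k + 8));
-- other shapes of the indices make Agda unfold the tables symbolically.
excessTable-periodic : ∀ k → excessTable (k ℕ.+ 8) ≡ excessTable (k ℕ.+ 4)
excessTable-periodic ℕ.zero  = by-decision ≡-dec-ExcessTable _
excessTable-periodic (suc k) = cong extend (excessTable-periodic k)

bonus : ℕ → ℤ
bonus m = if ⌊ m % 4 ≟ 1 ⌋ then + 1 else + 0

bonus-periodic : ∀ m → bonus (4 ℕ.+ m) ≡ bonus m
bonus-periodic m = cong (λ r → if ⌊ r ≟ 1 ⌋ then + 1 else + 0)
  (trans (cong (_% 4) (ℕP.+-comm 4 m)) (ℕ.[m+n]%n≡m%n m 4))

-- The endpoints of cong are given explicitly: inferring them would make Agda unfold the tables.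
minExcess-bonus : ∀ k → minExcess (4 ℕ.+ k) ≡ just (bonus (5 ℕ.+ k))
minExcess-bonus 0 = by-decision (Maybe.≡-dec ℤ._≟_) _
minExcess-bonus 1 = by-decision (Maybe.≡-dec ℤ._≟_) _
minExcess-bonus 2 = by-decision (Maybe.≡-dec ℤ._≟_) _
minExcess-bonus 3 = by-decision (Maybe.≡-dec ℤ._≟_) _
minExcess-bonus (suc (suc (suc (suc k)))) = begin
  minExcess (4 ℕ.+ suc (suc (suc (suc k))))     ≡⟨ cong minExcess {4 ℕ.+ suc (suc (suc (suc k)))} {k ℕ.+ 8}
                                                      (ℕP.+-comm 8 k) ⟩
  minExcess (k ℕ.+ 8)                           ≡⟨ cong minExcessOf (excessTable-periodic k) ⟩
  minExcess (k ℕ.+ 4)                           ≡⟨ cong minExcess {k ℕ.+ 4} {4 ℕ.+ k} (ℕP.+-comm k 4) ⟩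
  minExcess (4 ℕ.+ k)                           ≡⟨ minExcess-bonus k ⟩
  just (bonus (5 ℕ.+ k))                        ≡⟨ cong just (bonus-periodic (5 ℕ.+ k)) ⟨
  just (bonus (5 ℕ.+ suc (suc (suc (suc k)))))  ∎
  where open ≡-Reasoning

bonus-target : ∀ m → (if ⌊ m % 4 ≟ 1 ⌋ then + (suc m) else + m) ≡ + m + bonus m
bonus-target m with ⌊ m % 4 ≟ 1 ⌋
... | true  = cong +_ (ℕP.+-comm 1 m)
... | false = sym (ℤP.+-identityʳ (+ m))

theorem7 : (m : ℕ) → 5 ≤ m →
    GammaSdR≡ m (if ⌊ m % 4 ≟ 1 ⌋ then + (suc m) else + m)
theorem7 m 5≤m with ℕP.m≤n⇒∃[o]m+o≡n 5≤m
... | k , refl = subst (GammaSdR≡ (5 ℕ.+ k)) (sym (bonus-target (5 ℕ.+ k)))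
                   (minExcess⇒gammaSdR (4 ℕ.+ k) (minExcess-bonus k))
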